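{- If a graph $G$ has $n$ vertices and at least $m\ge 4n$ edges, then it has a subgraph with diameter at most $4$ and at least $\frac{m^2}{8n^2}$ edges.
   Context: The diameter of a graph is the maximum distance between two of its vertices ($\infty$ if disconnected). -}

module Defs where

open import Data.Bool using (Bool; true; false; if_then_else_)
open import Data.Nat using (ℕ; zero; suc; _≤_)
open import Data.Fin using (Fin; toℕ)
open import Data.List using (List; length; filter; cartesianProduct; allFin)
open import Data.Product using (_×_; _,_; proj₁; proj₂; ∃-syntax)
open import Data.Nat using (_<?_)
open import Relation.Nullary.Decidable using (_×-dec_)
open import Data.Bool using (T)
open import Data.Bool.Properties using (T?)
open import Relation.Binary.PropositionalEquality using (_≡_)

record Graph (n : ℕ) : Set where
  field
    adj    : Fin n → Fin n → Bool
    sym    : ∀ u v → adj u v ≡ adj v u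
    irrefl : ∀ v → adj v v ≡ false
open Graph public

edgeCount : ∀ {n} → Graph n → ℕ
edgeCount {n} G =
  length (filter (λ p → (toℕ (proj₁ p) <? toℕ (proj₂ p)) ×-dec T? (adj G (proj₁ p) (proj₂ p)))
                 (cartesianProduct (allFin n) (allFin n)))

data Walk {n : ℕ} (G : Graph n) : Fin n → Fin n → ℕ → Set where
  here : ∀ {u} → Walk G u u zero
  step : ∀ {u w v k} → adj G u w ≡ true → Walk G w v k → Walk G u v (suc k)

record Subgraph {n : ℕ} (G : Graph n) : Set where
  field
    verts   : Fin n → Bool
    graph   : Graph n
    edgeSub : ∀ u v → adj graph u v ≡ true → adj G u v ≡ true
    edgeIn  : ∀ u v → adj graph u v ≡ true → verts u ≡ true
open Subgraph public

DiamAtMost : ∀ {n} {G : Graph n} → Subgraph G → ℕ → Set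
DiamAtMost S d = ∀ u v → verts S u ≡ true → verts S v ≡ true →
  ∃[ k ] (k ≤ d × Walk (graph S) u v k)

-- For a vertex v let S(v) be the sum of the degrees of the neighbours of v.
-- Summing S over all vertices counts every vertex u exactly deg(u) times, so
-- Σ S(v) = Σ deg(u)², and by Cauchy–Schwarz some v has
-- n² S(v) ≥ n Σ deg(u)² ≥ (Σ deg(u))² = 4 e(G)².  Let H be the subgraph of
-- the edges having an endpoint adjacent to v.  Every vertex of H is within
-- distance 2 of v, so H has diameter at most 4, and every path v – u – w of G
-- ends in an edge uw of H, so S(v) ≤ 2 e(H).  Hence 2 e(G)² ≤ n² e(H).
module Submission where

open import Defs hiding (sym)
open import Data.Bool using (Bool; true; false; _∧_; _∨_; _≟_)
open import Data.Bool.Properties using (T?; ∨-comm; ∨-zeroʳ; ∧-zeroʳ)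
open import Data.Fin using (Fin; toℕ; zero; suc)
open import Data.Fin.Properties using (toℕ-injective; any?)
open import Data.List using (List; _++_; length; filter; tabulate; cartesianProduct; map)
open import Data.List.Properties using (length-++; filter-++; map-tabulate)
open import Data.Nat using (ℕ; zero; suc; _+_; _*_; _≤_; _<?_; _≤?_; z≤n; s≤s)
open import Data.Nat.Properties
  using ( +-*-semiring; +-comm; *-comm; +-identityʳ; ≤-refl; ≤-reflexive; ≤-trans; ≤-total
        ; <⇒≤; ≰⇒>; <-cmp; m≤m+n; m≤n*m; m≤n⇒∃[o]m+o≡n
        ; +-mono-≤; *-mono-≤; *-monoˡ-≤; *-monoʳ-≤; *-cancelˡ-≤; module ≤-Reasoning )
open import Data.Nat.Tactic.RingSolver using (solve-∀)
open import Algebra.Properties.Semiring.Sum +-*-semiring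
  using (sum-syntax; sum-cong-≗; ∑-comm; ∑-distrib-+; *-distribˡ-sum; *-distribʳ-sum)
open import Data.Product using (Σ; _×_; _,_; proj₁; proj₂; ∃-syntax)
open import Data.Sum using (_⊎_; inj₁; inj₂; [_,_]′)
open import Function using (_∘_; id)
open import Relation.Binary using (tri<; tri≈; tri>)
open import Relation.Binary.PropositionalEquality
open import Relation.Nullary using (yes; no; does)
open import Relation.Nullary.Decidable using (dec-true; dec-false; _×-dec_)
open import Relation.Unary using (Pred; Decidable)

∑-mono-≤ : ∀ {n} {f g : Fin n → ℕ} → (∀ i → f i ≤ g i) → ∑[ i < n ] f i ≤ ∑[ i < n ] g i
∑-mono-≤ {zero}  _   = z≤n
∑-mono-≤ {suc n} f≤g = +-mono-≤ (f≤g zero) (∑-mono-≤ (f≤g ∘ suc))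

∑-const : ∀ n c → ∑[ i < n ] c ≡ n * c
∑-const zero    c = refl
∑-const (suc n) c = cong (c +_) (∑-const n c)

2*m*n≤m*m+n*n : ∀ m n → 2 * (m * n) ≤ m * m + n * n
2*m*n≤m*m+n*n m n = [ ordered , flipped ]′ (≤-total m n)
  where
  gap : ∀ a k → 2 * (a * (a + k)) + k * k ≡ a * a + (a + k) * (a + k)
  gap = solve-∀

  ordered : ∀ {a b} → a ≤ b → 2 * (a * b) ≤ a * a + b * b
  ordered {a} a≤b with m≤n⇒∃[o]m+o≡n a≤b
  ... | k , refl = ≤-trans (m≤m+n _ (k * k)) (≤-reflexive (gap a k))

  flipped : n ≤ m → 2 * (m * n) ≤ m * m + n * n
  flipped n≤m = subst₂ _≤_ (cong (2 *_) (*-comm n m)) (+-comm (n * n) (m * m)) (ordered n≤m)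

∑-square-≤ : ∀ {n} (f : Fin n → ℕ) → (∑[ i < n ] f i) * (∑[ i < n ] f i) ≤ n * ∑[ i < n ] (f i * f i)
∑-square-≤ {n} f = *-cancelˡ-≤ 2 (begin
  2 * (F * F)
    ≡⟨ cong (2 *_) square-as-double-sum ⟩
  2 * ∑[ i < n ] ∑[ j < n ] (f i * f j)
    ≡⟨ trans (*-distribˡ-sum 2 (λ i → ∑[ j < n ] (f i * f j)))
             (sum-cong-≗ (λ i → *-distribˡ-sum 2 (λ j → f i * f j))) ⟩
  ∑[ i < n ] ∑[ j < n ] (2 * (f i * f j))
    ≤⟨ ∑-mono-≤ (λ i → ∑-mono-≤ (λ j → 2*m*n≤m*m+n*n (f i) (f j))) ⟩
  ∑[ i < n ] ∑[ j < n ] (f² i + f² j)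
    ≡⟨ sum-cong-≗ (λ i → trans (∑-distrib-+ (λ _ → f² i) f²) (cong (_+ Q) (∑-const n (f² i)))) ⟩
  ∑[ i < n ] (n * f² i + Q)
    ≡⟨ ∑-distrib-+ (λ i → n * f² i) (λ _ → Q) ⟩
  ∑[ i < n ] (n * f² i) + ∑[ i < n ] Q
    ≡⟨ cong₂ _+_ (sym (*-distribˡ-sum n f²)) (∑-const n Q) ⟩
  n * Q + n * Q
    ≡⟨ cong (n * Q +_) (sym (+-identityʳ (n * Q))) ⟩
  2 * (n * Q) ∎)
  where
  open ≤-Reasoning
  f² : Fin n → ℕ
  f² i = f i * f i
  F Q : ℕ
  F = ∑[ i < n ] f i
  Q = ∑[ i < n ] f² i

  square-as-double-sum : F * F ≡ ∑[ i < n ] ∑[ j < n ] (f i * f j)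
  square-as-double-sum = trans (*-distribʳ-sum F f) (sum-cong-≗ (λ i → *-distribˡ-sum (f i) f))

∃-maximum : ∀ {n} (f : Fin (suc n) → ℕ) → ∃[ v ] (∀ w → f w ≤ f v)
∃-maximum {zero}  f = zero , λ { zero → ≤-refl }
∃-maximum {suc n} f with ∃-maximum (f ∘ suc)
... | v , max with f zero ≤? f (suc v)
...   | yes f₀≤ = suc v , λ { zero → f₀≤ ; (suc w) → max w }
...   | no  f₀≰ = zero , λ { zero → ≤-refl ; (suc w) → ≤-trans (max w) (<⇒≤ (≰⇒> f₀≰)) }

∃-≥-average : ∀ {n} (f : Fin (suc n) → ℕ) → ∃[ v ] (∑[ i < suc n ] f i ≤ suc n * f v)
∃-≥-average {n} f with ∃-maximum f
... | v , max = v , ≤-trans (∑-mono-≤ max) (≤-reflexive (∑-const (suc n) (f v)))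

χ : Bool → ℕ
χ true  = 1
χ false = 0

module _ {a p} {A : Set a} {P : Pred A p} (P? : Decidable P) where

  length-filter-tabulate : ∀ {n} (f : Fin n → A) →
    length (filter P? (tabulate f)) ≡ ∑[ i < n ] χ (does (P? (f i)))
  length-filter-tabulate {zero}  f = refl
  length-filter-tabulate {suc n} f with does (P? (f zero))
  ... | true  = cong suc (length-filter-tabulate (f ∘ suc))
  ... | false = length-filter-tabulate (f ∘ suc)

module _ {a b p} {A : Set a} {B : Set b} {P : Pred (A × B) p} (P? : Decidable P) where

  length-filter-cartesianProduct : ∀ {m n} (f : Fin m → A) (g : Fin n → B) →
    length (filter P? (cartesianProduct (tabulate f) (tabulate g)))
      ≡ ∑[ i < m ] ∑[ j < n ] χ (does (P? (f i , g j)))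
  length-filter-cartesianProduct {zero}  f g = refl
  length-filter-cartesianProduct {suc m} {n} f g = begin
    length (filter P? (row ++ rest))               ≡⟨ cong length (filter-++ P? row rest) ⟩
    length (filter P? row ++ filter P? rest)       ≡⟨ length-++ (filter P? row) ⟩
    length (filter P? row) + length (filter P? rest)
      ≡⟨ cong₂ _+_ (trans (cong (length ∘ filter P?) (map-tabulate g (f zero ,_)))
                          (length-filter-tabulate P? ((f zero ,_) ∘ g)))
                   (length-filter-cartesianProduct (f ∘ suc) g) ⟩
    ∑[ i < suc m ] ∑[ j < n ] χ (does (P? (f i , g j))) ∎
    where
    open ≡-Reasoning
    row rest : List (A × B)
    row  = map (f zero ,_) (tabulate g)
    rest = cartesianProduct (tabulate (f ∘ suc)) (tabulate g)

_≺_ : ∀ {n} → Fin n → Fin n → Bool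
i ≺ j = does (toℕ i <? toℕ j)

edgeCount≡∑ : ∀ {n} (G : Graph n) → edgeCount G ≡ ∑[ i < n ] ∑[ j < n ] χ (i ≺ j ∧ adj G i j)
edgeCount≡∑ G = length-filter-cartesianProduct
  (λ p → (toℕ (proj₁ p) <? toℕ (proj₂ p)) ×-dec T? (adj G (proj₁ p) (proj₂ p))) id id

χ-adj-split : ∀ {n} (G : Graph n) (i j : Fin n) →
  χ (adj G i j) ≡ χ (i ≺ j ∧ adj G i j) + χ (j ≺ i ∧ adj G j i)
χ-adj-split G i j with <-cmp (toℕ i) (toℕ j)
... | tri< i<j _ j≮i rewrite dec-true (toℕ i <? toℕ j) i<j | dec-false (toℕ j <? toℕ i) j≮i =
  sym (+-identityʳ _)
... | tri> i≮j _ j<i rewrite dec-false (toℕ i <? toℕ j) i≮j | dec-true (toℕ j <? toℕ i) j<i =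
  cong χ (Graph.sym G i j)
... | tri≈ _ i≡j _ with refl ← toℕ-injective i≡j rewrite Graph.irrefl G i | ∧-zeroʳ (i ≺ i) = refl

degree : ∀ {n} → Graph n → Fin n → ℕ
degree {n} G u = ∑[ w < n ] χ (adj G u w)

handshake : ∀ {n} (G : Graph n) → ∑[ u < n ] degree G u ≡ 2 * edgeCount G
handshake {n} G = begin
  ∑[ u < n ] ∑[ w < n ] χ (adj G u w)
    ≡⟨ sum-cong-≗ (λ u → sum-cong-≗ (χ-adj-split G u)) ⟩
  ∑[ u < n ] ∑[ w < n ] (forward u w + forward w u)
    ≡⟨ sum-cong-≗ (λ u → ∑-distrib-+ (forward u) (λ w → forward w u)) ⟩
  ∑[ u < n ] (∑[ w < n ] forward u w + ∑[ w < n ] forward w u)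
    ≡⟨ ∑-distrib-+ (λ u → ∑[ w < n ] forward u w) (λ u → ∑[ w < n ] forward w u) ⟩
  E′ + ∑[ u < n ] ∑[ w < n ] forward w u
    ≡⟨ cong (E′ +_) (∑-comm (λ u w → forward w u)) ⟩
  E′ + E′
    ≡⟨ cong (λ x → x + x) (sym (edgeCount≡∑ G)) ⟩
  E + E
    ≡⟨ cong (E +_) (sym (+-identityʳ E)) ⟩
  2 * E ∎
  where
  open ≡-Reasoning
  forward : Fin n → Fin n → ℕ
  forward i j = χ (i ≺ j ∧ adj G i j)
  E E′ : ℕ
  E  = edgeCount G
  E′ = ∑[ i < n ] ∑[ j < n ] forward i j

module _ {n} {G : Graph n} where

  _++ʷ_ : ∀ {u w v k l} → Walk G u w k → Walk G w v l → Walk G u v (k + l)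
  here     ++ʷ q = q
  step e p ++ʷ q = step e (p ++ʷ q)

  reverse : ∀ {u v k} → Walk G u v k → Walk G v u k
  reverse here = here
  reverse {k = suc k} (step {u = u} {w} e p) =
    subst (Walk G _ _) (+-comm k 1) (reverse p ++ʷ step (trans (Graph.sym G w u) e) here)

∧-true⁻ : ∀ {a b} → a ∧ b ≡ true → a ≡ true × b ≡ true
∧-true⁻ {true} b≡true = refl , b≡true

∨-true⁻ : ∀ {a b} → a ∨ b ≡ true → a ≡ true ⊎ b ≡ true
∨-true⁻ {true}  _       = inj₁ refl
∨-true⁻ {false} b≡true = inj₂ b≡true

neighbourDegreeSum : ∀ {n} → Graph n → Fin n → ℕ
neighbourDegreeSum {n} G v = ∑[ u < n ] (χ (adj G v u) * degree G u)

∑-neighbourDegreeSum : ∀ {n} (G : Graph n) →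
  ∑[ v < n ] neighbourDegreeSum G v ≡ ∑[ u < n ] (degree G u * degree G u)
∑-neighbourDegreeSum {n} G = begin
  ∑[ v < n ] ∑[ u < n ] (χ (adj G v u) * degree G u)
    ≡⟨ ∑-comm (λ v u → χ (adj G v u) * degree G u) ⟩
  ∑[ u < n ] ∑[ v < n ] (χ (adj G v u) * degree G u)
    ≡⟨ sum-cong-≗ (λ u → sym (*-distribʳ-sum (degree G u) (λ v → χ (adj G v u)))) ⟩
  ∑[ u < n ] ((∑[ v < n ] χ (adj G v u)) * degree G u)
    ≡⟨ sum-cong-≗ (λ u → cong (_* degree G u) (sum-cong-≗ (λ v → cong χ (Graph.sym G v u)))) ⟩
  ∑[ u < n ] (degree G u * degree G u) ∎
  where open ≡-Reasoning

module Neighbourhood {n} (G : Graph n) (v : Fin n) where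

  nearAdj : Fin n → Fin n → Bool
  nearAdj x y = adj G x y ∧ (adj G v x ∨ adj G v y)

  H : Graph n
  H = record
    { adj    = nearAdj
    ; sym    = λ x y → cong₂ _∧_ (Graph.sym G x y) (∨-comm (adj G v x) (adj G v y))
    ; irrefl = λ x → cong (_∧ (adj G v x ∨ adj G v x)) (Graph.irrefl G x)
    }

  nearAdj-intro : ∀ {x y} → adj G x y ≡ true → adj G v x ≡ true ⊎ adj G v y ≡ true →
    nearAdj x y ≡ true
  nearAdj-intro {x} xy (inj₁ vx) rewrite xy | vx = refl
  nearAdj-intro {x} xy (inj₂ vy) rewrite xy | vy = ∨-zeroʳ (adj G v x)

  S : Subgraph G
  S = record
    { verts   = λ x → does (any? λ y → nearAdj x y ≟ true)
    ; graph   = H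
    ; edgeSub = λ x y → proj₁ ∘ ∧-true⁻
    ; edgeIn  = λ x y xy → dec-true (any? λ z → nearAdj x z ≟ true) (y , xy)
    }

  vertex-near-centre : ∀ x → verts S x ≡ true → ∃[ k ] (k ≤ 2 × Walk H x v k)
  vertex-near-centre x x∈S with any? (λ y → nearAdj x y ≟ true) | x∈S
  ... | yes (y , xy) | _ with ∧-true⁻ xy
  ...   | x~y , vx∨vy with ∨-true⁻ vx∨vy
  ...     | inj₁ vx = 1 , s≤s z≤n , step (nearAdj-intro (trans (Graph.sym G x v) vx) (inj₁ vx)) here
  ...     | inj₂ vy = 2 , ≤-refl
    , step (nearAdj-intro x~y (inj₂ vy))
        (step (nearAdj-intro (trans (Graph.sym G y v) vy) (inj₁ vy)) here)

  diameter≤4 : DiamAtMost S 4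
  diameter≤4 x y x∈S y∈S with vertex-near-centre x x∈S | vertex-near-centre y y∈S
  ... | k , k≤2 , x→v | l , l≤2 , y→v = k + l , +-mono-≤ k≤2 l≤2 , x→v ++ʷ reverse y→v

  neighbourDegreeSum≤2*edgeCount : neighbourDegreeSum G v ≤ 2 * edgeCount H
  neighbourDegreeSum≤2*edgeCount = begin
    ∑[ u < n ] (χ (adj G v u) * degree G u)
      ≡⟨ sum-cong-≗ (λ u → *-distribˡ-sum (χ (adj G v u)) (λ w → χ (adj G u w))) ⟩
    ∑[ u < n ] ∑[ w < n ] (χ (adj G v u) * χ (adj G u w))
      ≤⟨ ∑-mono-≤ (λ u → ∑-mono-≤ (λ w → path-through-neighbour u w)) ⟩
    ∑[ u < n ] degree H u
      ≡⟨ handshake H ⟩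
    2 * edgeCount H ∎
    where
    open ≤-Reasoning
    path-through-neighbour : ∀ u w → χ (adj G v u) * χ (adj G u w) ≤ χ (nearAdj u w)
    path-through-neighbour u w with adj G v u | adj G u w
    ... | true  | true  = ≤-refl
    ... | true  | false = z≤n
    ... | false | _     = z≤n

∃-dense-neighbourhood : ∀ {n} (G : Graph (suc n)) →
  ∃[ v ] (2 * (edgeCount G * edgeCount G) ≤ suc n * suc n * edgeCount (Neighbourhood.H G v))
∃-dense-neighbourhood {n} G with ∃-≥-average (neighbourDegreeSum G)
... | v , average≤ = v , *-cancelˡ-≤ 2 (begin
  2 * (2 * (E * E))
    ≡⟨ square-of-double E ⟩
  (2 * E) * (2 * E)
    ≡⟨ cong (λ x → x * x) (sym (handshake G)) ⟩
  D * D
    ≤⟨ ∑-square-≤ (degree G) ⟩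
  N * ∑[ u < N ] (degree G u * degree G u)
    ≡⟨ cong (N *_) (sym (∑-neighbourDegreeSum G)) ⟩
  N * ∑[ u < N ] neighbourDegreeSum G u
    ≤⟨ *-monoʳ-≤ N average≤ ⟩
  N * (N * neighbourDegreeSum G v)
    ≤⟨ *-monoʳ-≤ N (*-monoʳ-≤ N (neighbourDegreeSum≤2*edgeCount)) ⟩
  N * (N * (2 * e))
    ≡⟨ reassociate N e ⟩
  2 * (N * N * e) ∎)
  where
  open ≤-Reasoning
  open Neighbourhood G v using (H; neighbourDegreeSum≤2*edgeCount)
  N E D e : ℕ
  N = suc n
  E = edgeCount G
  D = ∑[ u < N ] degree G u
  e = edgeCount H

  square-of-double : ∀ x → 2 * (2 * (x * x)) ≡ (2 * x) * (2 * x)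
  square-of-double = solve-∀

  reassociate : ∀ x y → x * (x * (2 * y)) ≡ 2 * (x * x * y)
  reassociate = solve-∀

lemma2p13 : (n m : ℕ) (G : Graph n) → 4 * n ≤ m → m ≤ edgeCount G →
    Σ (Subgraph G) (λ H → DiamAtMost H 4 × m * m ≤ 8 * (n * n) * edgeCount (graph H))
lemma2p13 zero _ G _ z≤n =
  record { verts = λ () ; graph = G ; edgeSub = λ () ; edgeIn = λ () } , (λ ()) , z≤n
lemma2p13 (suc n) m G _ m≤E = S , diameter≤4 , (begin
  m * m           ≤⟨ *-mono-≤ m≤E m≤E ⟩
  E * E           ≤⟨ m≤n*m (E * E) 2 ⟩
  2 * (E * E)     ≤⟨ dense ⟩
  N * N * e       ≤⟨ *-monoˡ-≤ e (m≤n*m (N * N) 8) ⟩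
  8 * (N * N) * e ∎)
  where
  open ≤-Reasoning
  v : Fin (suc n)
  v = proj₁ (∃-dense-neighbourhood G)
  open Neighbourhood G v using (H; S; diameter≤4)
  N E e : ℕ
  N = suc n
  E = edgeCount G
  e = edgeCount H
  dense : 2 * (E * E) ≤ N * N * e
  dense = proj₂ (∃-dense-neighbourhood G)
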